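{- Let $a_1,a_2,\dots$ be a fixed sequence of positive integers, and define polynomials $Q_n(x)$ by $Q_0(x)=1$, $Q_1(x)=x+a_1$ and $Q_n(x)=(-1)^{n+1}a_nQ_{n-1}(x)+x(x+1)Q_{n-2}(x)$ for $n\ge 2$. Then for all $n\ge 2$, $Q_n(x)=p_n(x,y)$ with $y=x+1$, where $p_n$ is as defined in the context.
   Context: For a positive integer $k$ and $1\le l\le k$, let $I_{k,l}$ be the set of strictly increasing sequences $(t_1,\dots,t_l)$ in $\{1,\dots,k\}$ with $t_i\equiv k+i-l\pmod 2$ for all $i$; set $\gamma_k(l)=\sum_{(t_1,\dots,t_l)\in I_{k,l}}a_{t_1}\cdots a_{t_l}$ for $1\le l\le k$ and $\gamma_k(0)=1$. For $n\ge 2$ write $n=2m+r_0$ with $r_0\in\{0,1\}$ and let $r_1\in\{0,1\}$ with $r_1\equiv r_0+1\pmod 2$. With $y=x+1$, define $$p_n(x,y)=x^{r_0}\sum_{k=0}^{m}(-1)^{m-k}x^ky^k\gamma_n(n-2k-r_0)+x^{r_1}\sum_{k=0}^{m-r_1}(-1)^{m-k}x^ky^k\gamma_n(n-2k-r_1).$$ -}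

module Defs where

open import Data.Nat as ℕ using (ℕ; zero; suc; _∸_; _%_)
open import Data.Integer as ℤ using (ℤ; +_; -_; _+_; _*_; _^_)
open import Data.List using (List; []; _∷_; map; _++_; length; upTo; filter; foldr)
open import Data.Bool using (Bool; true; false; _∧_)
open import Relation.Binary.PropositionalEquality using (_≡_)
open import Relation.Nullary.Decidable using (⌊_⌋)

sumℤ : List ℤ → ℤ
sumℤ = foldr _+_ (+ 0)

prodℤ : List ℤ → ℤ
prodℤ = foldr _*_ (+ 1)

-- Coefficient sequence a₁, a₂, … is a function ℕ → ℕ (index 0 unused).

oneTo : ℕ → List ℕ
oneTo k = map suc (upTo k)

-- all sub-lists of a list (order preserved); applied to [1..k] these are
-- exactly the strictly increasing sequences in {1,…,k}
sublists : List ℕ → List (List ℕ)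
sublists [] = [] ∷ []
sublists (x ∷ xs) = map (x ∷_) (sublists xs) ++ sublists xs

-- parity condition t_i ≡ k + i - l (mod 2), i.e. (t_i + l) ≡ (k + i) mod 2,
-- checked for the positions i = start, start+1, …
parityOK : ℕ → ℕ → ℕ → List ℕ → Bool
parityOK k l i [] = true
parityOK k l i (t ∷ ts) =
  ⌊ ((t ℕ.+ l) % 2) ℕ.≟ ((k ℕ.+ i) % 2) ⌋ ∧ parityOK k l (suc i) ts

inI : ℕ → ℕ → List ℕ → Bool
inI k l ts = ⌊ length ts ℕ.≟ l ⌋ ∧ parityOK k l 1 ts

I : ℕ → ℕ → List (List ℕ)
I k l = filter (λ ts → Data.Bool._≟_ (inI k l ts) true) (sublists (oneTo k))

γ : (ℕ → ℕ) → ℕ → ℕ → ℤ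
γ a k zero = + 1
γ a k (suc l) = sumℤ (map (λ ts → prodℤ (map (λ t → + a t) ts)) (I k (suc l)))

Σto : ℕ → (ℕ → ℤ) → ℤ
Σto m f = sumℤ (map f (upTo (suc m)))

Q : (ℕ → ℕ) → ℤ → ℕ → ℤ
Q a x zero = + 1
Q a x (suc zero) = x + + a 1
Q a x (suc (suc n)) =
  ((- + 1) ^ (n ℕ.+ 3)) * (+ a (n ℕ.+ 2)) * Q a x (suc n) + x * (x + + 1) * Q a x n

p : (ℕ → ℕ) → ℕ → ℤ → ℤ → ℤ
p a n x y =
  (x ^ r₀) * Σto m (λ k → ((- + 1) ^ (m ∸ k)) * (x ^ k) * (y ^ k) * γ a n (n ∸ (2 ℕ.* k) ∸ r₀))
  + (x ^ r₁) * Σto (m ∸ r₁) (λ k → ((- + 1) ^ (m ∸ k)) * (x ^ k) * (y ^ k) * γ a n (n ∸ (2 ℕ.* k) ∸ r₁))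
  where
  m = n ℕ./ 2
  r₀ = n % 2
  r₁ = 1 ∸ r₀

{-# OPTIONS --safe #-}
-- Splitting the sequences in I_{k+2,l+1} by whether they end in k + 2 (they cannot end in k + 1)
-- gives γ_{k+2}(l+1) = a_{k+2} γ_{k+1}(l) + γ_k(l+1), hence also γ_k(l) = 0 for l > k.
-- With z = x(x+1), the two sums in p_n are the alternating sums
-- E_n(M) = Σ_j (-1)^j z^(M-j) γ_n(2j) and O_n(M) = Σ_j (-1)^j z^(M-j) γ_n(2j+1):
-- p_n = x E_n(m) + O_n(m) for n = 2m+1 and p_n = E_n(m+1) - x O_n(m) for n = 2m+2.
-- The recurrence for γ turns into E_{n+2}(M+1) = E_n(M+1) - a_{n+2} O_{n+1}(M) and
-- O_{n+2}(M) = a_{n+2} E_{n+1}(M) + O_n(M), and the vanishing of γ_n beyond n means that raising M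
-- past n/2 just multiplies by z. Together these reproduce the recurrence of Q_n, so Q_n = p_n
-- follows by induction on m, for n = 2m+1 and n = 2m+2 simultaneously.
module Submission where

open import Defs
open import Data.Nat using (ℕ; _≤_; _<_)
open import Data.Integer using (ℤ; +_; _+_)
open import Relation.Binary.PropositionalEquality using (_≡_)

open import Data.Bool using (Bool; true; false; _∧_; if_then_else_)
import Data.Bool as Bool
open import Data.Bool.Properties using (∧-assoc; ∧-identityʳ; ∧-zeroʳ)
open import Data.Integer using (_*_; _-_; -1ℤ; _^_)
import Data.Integer.Properties as ℤₚ
open import Algebra.Properties.CommutativeSemigroup ℤₚ.+-commutativeSemigroup
  using (interchange)
open import Data.Integer.Tactic.RingSolver using (solve-∀)
open import Data.List using (List; []; _∷_; [_]; _++_; _∷ʳ_; map; length; upTo; applyUpTo; filter)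
import Data.List.Properties as Listₚ
open import Data.Nat as ℕ using (zero; suc; _∸_; _%_; _/_; z≤n; s≤s)
open import Data.Nat.DivMod using (%-distribˡ-+; +-distrib-/-∣ʳ; m*n/n≡m; [m+kn]%n≡m%n; m*n%n≡0)
open import Data.Nat.Divisibility using (divides)
import Data.Nat.Properties as ℕₚ
open import Data.Product using (_×_; _,_; proj₁; proj₂)
open import Function using (_∘_; mk⇔)
open import Function.Bundles using (_⇔_)
open import Relation.Binary.PropositionalEquality
  using (_≢_; refl; sym; trans; cong; cong₂; module ≡-Reasoning)
open import Relation.Nullary using (¬_; Dec; yes; no; contradiction)
open import Relation.Nullary.Decidable using (⌊_⌋; isYes≗does; dec-true; dec-false; does-⇔)

open ≡-Reasoning

module _ {A : Set} where

  ⌊⌋-true : (a? : Dec A) → A → ⌊ a? ⌋ ≡ true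
  ⌊⌋-true a? a = trans (isYes≗does a?) (dec-true a? a)

  ⌊⌋-false : (a? : Dec A) → ¬ A → ⌊ a? ⌋ ≡ false
  ⌊⌋-false a? ¬a = trans (isYes≗does a?) (dec-false a? ¬a)

⌊⌋-⇔ : ∀ {A B : Set} → A ⇔ B → (a? : Dec A) (b? : Dec B) → ⌊ a? ⌋ ≡ ⌊ b? ⌋
⌊⌋-⇔ A⇔B a? b? = trans (isYes≗does a?) (trans (does-⇔ A⇔B a? b?) (sym (isYes≗does b?)))

-- Sums over sublists

sumℤ-++ : ∀ xs ys → sumℤ (xs ++ ys) ≡ sumℤ xs + sumℤ ys
sumℤ-++ []       ys = sym (ℤₚ.+-identityˡ _)
sumℤ-++ (x ∷ xs) ys = trans (cong (_+_ x) (sumℤ-++ xs ys)) (sym (ℤₚ.+-assoc x _ _))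

sumℤ-map-*ˡ : ∀ {A : Set} c (f : A → ℤ) xs →
  sumℤ (map (λ s → c * f s) xs) ≡ c * sumℤ (map f xs)
sumℤ-map-*ˡ c f []       = sym (ℤₚ.*-zeroʳ c)
sumℤ-map-*ˡ c f (x ∷ xs) =
  trans (cong (_+_ (c * f x)) (sumℤ-map-*ˡ c f xs)) (sym (ℤₚ.*-distribˡ-+ c _ _))

sumℤ-map-0 : ∀ {A : Set} (f : A → ℤ) xs → (∀ s → f s ≡ + 0) → sumℤ (map f xs) ≡ + 0
sumℤ-map-0 f []       f≡0 = refl
sumℤ-map-0 f (x ∷ xs) f≡0 = cong₂ _+_ (f≡0 x) (sumℤ-map-0 f xs f≡0)

sumℤ-map-cong : ∀ {A : Set} {f g : A → ℤ} → (∀ s → f s ≡ g s) → ∀ xs →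
  sumℤ (map f xs) ≡ sumℤ (map g xs)
sumℤ-map-cong f≗g xs = cong sumℤ (Listₚ.map-cong f≗g xs)

sumℤ-filter : ∀ {A : Set} (f : A → ℤ) (P : A → Bool) xs →
  sumℤ (map f (filter (λ s → P s Bool.≟ true) xs)) ≡ sumℤ (map (λ s → if P s then f s else + 0) xs)
sumℤ-filter f P []       = refl
sumℤ-filter f P (x ∷ xs) with P x
... | true  = cong (_+_ (f x)) (sumℤ-filter f P xs)
... | false = trans (sumℤ-filter f P xs) (sym (ℤₚ.+-identityˡ _))

prodℤ-map-∷ʳ : ∀ {A : Set} (f : A → ℤ) xs y → prodℤ (map f (xs ∷ʳ y)) ≡ prodℤ (map f xs) * f y
prodℤ-map-∷ʳ f []       y = ℤₚ.*-comm (f y) (+ 1)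
prodℤ-map-∷ʳ f (x ∷ xs) y =
  trans (cong (f x *_) (prodℤ-map-∷ʳ f xs y)) (sym (ℤₚ.*-assoc (f x) _ (f y)))

sumℤ-sublists-∷ : ∀ (f : List ℕ → ℤ) x xs →
  sumℤ (map f (sublists (x ∷ xs))) ≡ sumℤ (map (f ∘ (x ∷_)) (sublists xs)) + sumℤ (map f (sublists xs))
sumℤ-sublists-∷ f x xs = begin
  sumℤ (map f (map (x ∷_) S ++ S))            ≡⟨ cong sumℤ (Listₚ.map-++ f (map (x ∷_) S) S) ⟩
  sumℤ (map f (map (x ∷_) S) ++ map f S)      ≡⟨ sumℤ-++ (map f (map (x ∷_) S)) (map f S) ⟩
  sumℤ (map f (map (x ∷_) S)) + sumℤ (map f S) ≡⟨ cong (_+ sumℤ (map f S)) (cong sumℤ (Listₚ.map-∘ S)) ⟨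
  sumℤ (map (f ∘ (x ∷_)) S) + sumℤ (map f S)   ∎
  where S = sublists xs

sumℤ-sublists-[] : ∀ (f : List ℕ → ℤ) xs → (∀ x s → f (x ∷ s) ≡ + 0) →
  sumℤ (map f (sublists xs)) ≡ f []
sumℤ-sublists-[] f []       f∷≡0 = ℤₚ.+-identityʳ (f [])
sumℤ-sublists-[] f (x ∷ xs) f∷≡0 = begin
  sumℤ (map f (sublists (x ∷ xs)))                               ≡⟨ sumℤ-sublists-∷ f x xs ⟩
  sumℤ (map (f ∘ (x ∷_)) (sublists xs)) + sumℤ (map f (sublists xs))
    ≡⟨ cong₂ _+_ (sumℤ-map-0 (f ∘ (x ∷_)) (sublists xs) (f∷≡0 x)) (sumℤ-sublists-[] f xs f∷≡0) ⟩
  + 0 + f []                                                     ≡⟨ ℤₚ.+-identityˡ (f []) ⟩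
  f []                                                           ∎

sumℤ-sublists-∷ʳ : ∀ (f : List ℕ → ℤ) xs y →
  sumℤ (map f (sublists (xs ∷ʳ y))) ≡
  sumℤ (map (λ s → f (s ∷ʳ y)) (sublists xs)) + sumℤ (map f (sublists xs))
sumℤ-sublists-∷ʳ f []       y = cong (_+ (f [] + + 0)) (sym (ℤₚ.+-identityʳ (f [ y ])))
sumℤ-sublists-∷ʳ f (x ∷ xs) y = begin
  sumℤ (map f (sublists (x ∷ (xs ∷ʳ y))))
    ≡⟨ sumℤ-sublists-∷ f x (xs ∷ʳ y) ⟩
  sumℤ (map (f ∘ (x ∷_)) (sublists (xs ∷ʳ y))) + sumℤ (map f (sublists (xs ∷ʳ y)))
    ≡⟨ cong₂ _+_ (sumℤ-sublists-∷ʳ (f ∘ (x ∷_)) xs y) (sumℤ-sublists-∷ʳ f xs y) ⟩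
  (Σ (λ s → f (x ∷ (s ∷ʳ y))) + Σ (f ∘ (x ∷_))) + (Σ (λ s → f (s ∷ʳ y)) + Σ f)
    ≡⟨ interchange (Σ (λ s → f (x ∷ (s ∷ʳ y)))) (Σ (f ∘ (x ∷_))) (Σ (λ s → f (s ∷ʳ y))) (Σ f) ⟩
  (Σ (λ s → f (x ∷ (s ∷ʳ y))) + Σ (λ s → f (s ∷ʳ y))) + (Σ (f ∘ (x ∷_)) + Σ f)
    ≡⟨ cong₂ _+_ (sumℤ-sublists-∷ (λ s → f (s ∷ʳ y)) x xs) (sumℤ-sublists-∷ f x xs) ⟨
  sumℤ (map (λ s → f (s ∷ʳ y)) (sublists (x ∷ xs))) + sumℤ (map f (sublists (x ∷ xs))) ∎
  where
  Σ : (List ℕ → ℤ) → ℤ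
  Σ g = sumℤ (map g (sublists xs))

oneTo-suc : ∀ k → oneTo (suc k) ≡ oneTo k ∷ʳ suc k
oneTo-suc k = trans (cong (map suc) (sym (Listₚ.upTo-∷ʳ k))) (Listₚ.map-++ suc (upTo k) [ k ])

-- The recurrence for γ

parityAt : ℕ → ℕ → ℕ → ℕ → Bool
parityAt k l i t = ⌊ (t ℕ.+ l) % 2 ℕ.≟ (k ℕ.+ i) % 2 ⌋

≟-suc : ∀ m n → ⌊ suc m ℕ.≟ suc n ⌋ ≡ ⌊ m ℕ.≟ n ⌋
≟-suc m n = ⌊⌋-⇔ (mk⇔ ℕₚ.suc-injective (cong suc)) (suc m ℕ.≟ suc n) (m ℕ.≟ n)

%2-cong-suc : ∀ {m n} → m % 2 ≡ n % 2 → suc m % 2 ≡ suc n % 2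
%2-cong-suc {m} {n} m≡n = begin
  (1 ℕ.+ m) % 2          ≡⟨ %-distribˡ-+ 1 m 2 ⟩
  (1 ℕ.+ m % 2) % 2      ≡⟨ cong (λ r → (1 ℕ.+ r) % 2) m≡n ⟩
  (1 ℕ.+ n % 2) % 2      ≡⟨ %-distribˡ-+ 1 n 2 ⟨
  (1 ℕ.+ n) % 2          ∎

n%2≢[1+n]%2 : ∀ n → n % 2 ≢ suc n % 2
n%2≢[1+n]%2 zero          ()
n%2≢[1+n]%2 (suc zero)    ()
n%2≢[1+n]%2 (suc (suc n)) = n%2≢[1+n]%2 n

-- Backwards, %2-cong-suc is applied once more: (2 + m) % 2 reduces to m % 2.
parity-≟-suc : ∀ m n → ⌊ suc m % 2 ℕ.≟ suc n % 2 ⌋ ≡ ⌊ m % 2 ℕ.≟ n % 2 ⌋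
parity-≟-suc m n =
  ⌊⌋-⇔ (mk⇔ (%2-cong-suc {suc m} {suc n}) (%2-cong-suc {m} {n})) (suc m % 2 ℕ.≟ suc n % 2) (m % 2 ℕ.≟ n % 2)

parityOK-+2 : ∀ k l i s → parityOK (2 ℕ.+ k) l i s ≡ parityOK k l i s
parityOK-+2 k l i []      = refl
parityOK-+2 k l i (t ∷ s) = cong (parityAt k l i t ∧_) (parityOK-+2 k l (suc i) s)

parityOK-suc : ∀ k l i s → parityOK (suc k) (suc l) i s ≡ parityOK k l i s
parityOK-suc k l i []      = refl
parityOK-suc k l i (t ∷ s) = cong₂ _∧_ parityAt-suc (parityOK-suc k l (suc i) s)
  where
  parityAt-suc : parityAt (suc k) (suc l) i t ≡ parityAt k l i t
  parityAt-suc = trans (cong (λ u → ⌊ u % 2 ℕ.≟ suc (k ℕ.+ i) % 2 ⌋) (ℕₚ.+-suc t l))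
                       (parity-≟-suc (t ℕ.+ l) (k ℕ.+ i))

parityOK-∷ʳ : ∀ k l i s t → parityOK k l i (s ∷ʳ t) ≡ parityOK k l i s ∧ parityAt k l (i ℕ.+ length s) t
parityOK-∷ʳ k l i []      t = trans (∧-identityʳ _) (cong (λ j → parityAt k l j t) (sym (ℕₚ.+-identityʳ i)))
parityOK-∷ʳ k l i (u ∷ s) t = begin
  parityAt k l i u ∧ parityOK k l (suc i) (s ∷ʳ t)
    ≡⟨ cong (parityAt k l i u ∧_) (parityOK-∷ʳ k l (suc i) s t) ⟩
  parityAt k l i u ∧ (parityOK k l (suc i) s ∧ parityAt k l (suc i ℕ.+ length s) t)
    ≡⟨ ∧-assoc (parityAt k l i u) (parityOK k l (suc i) s) _ ⟨
  (parityAt k l i u ∧ parityOK k l (suc i) s) ∧ parityAt k l (suc i ℕ.+ length s) t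
    ≡⟨ cong (λ j → (parityAt k l i u ∧ parityOK k l (suc i) s) ∧ parityAt k l j t) (ℕₚ.+-suc i (length s)) ⟨
  (parityAt k l i u ∧ parityOK k l (suc i) s) ∧ parityAt k l (i ℕ.+ suc (length s)) t ∎

≟-∧-subst : ∀ m n (P : ℕ → Bool) → ⌊ m ℕ.≟ n ⌋ ∧ P m ≡ ⌊ m ℕ.≟ n ⌋ ∧ P n
≟-∧-subst m n P with m ℕ.≟ n
... | yes refl = refl
... | no  _    = refl

inI-+2 : ∀ k l s → inI (2 ℕ.+ k) l s ≡ inI k l s
inI-+2 k l s = cong (⌊ length s ℕ.≟ l ⌋ ∧_) (parityOK-+2 k l 1 s)

-- Once the length test passes, the last entry t sits at position l + 1.
inI-∷ʳ : ∀ k l s t →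
  inI k (suc l) (s ∷ʳ t) ≡ ⌊ length s ℕ.≟ l ⌋ ∧ (parityOK k (suc l) 1 s ∧ parityAt k (suc l) (suc l) t)
inI-∷ʳ k l s t = begin
  ⌊ length (s ∷ʳ t) ℕ.≟ suc l ⌋ ∧ parityOK k (suc l) 1 (s ∷ʳ t)
    ≡⟨ cong₂ _∧_ length-test (parityOK-∷ʳ k (suc l) 1 s t) ⟩
  ⌊ length s ℕ.≟ l ⌋ ∧ (parityOK k (suc l) 1 s ∧ parityAt k (suc l) (suc (length s)) t)
    ≡⟨ ≟-∧-subst (length s) l (λ j → parityOK k (suc l) 1 s ∧ parityAt k (suc l) (suc j) t) ⟩
  ⌊ length s ℕ.≟ l ⌋ ∧ (parityOK k (suc l) 1 s ∧ parityAt k (suc l) (suc l) t) ∎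
  where
  length-test : ⌊ length (s ∷ʳ t) ℕ.≟ suc l ⌋ ≡ ⌊ length s ℕ.≟ l ⌋
  length-test = trans (cong (λ j → ⌊ j ℕ.≟ suc l ⌋)
                            (trans (Listₚ.length-++ s) (ℕₚ.+-comm (length s) 1)))
                      (≟-suc (length s) l)

inI-∷ʳ-top : ∀ k l s → inI (2 ℕ.+ k) (suc l) (s ∷ʳ (2 ℕ.+ k)) ≡ inI (suc k) l s
inI-∷ʳ-top k l s = begin
  inI (2 ℕ.+ k) (suc l) (s ∷ʳ (2 ℕ.+ k))
    ≡⟨ inI-∷ʳ (2 ℕ.+ k) l s (2 ℕ.+ k) ⟩
  ⌊ length s ℕ.≟ l ⌋ ∧ (parityOK (2 ℕ.+ k) (suc l) 1 s ∧ parityAt (2 ℕ.+ k) (suc l) (suc l) (2 ℕ.+ k))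
    ≡⟨ cong (λ b → ⌊ length s ℕ.≟ l ⌋ ∧ (parityOK (2 ℕ.+ k) (suc l) 1 s ∧ b))
            (⌊⌋-true ((2 ℕ.+ k ℕ.+ suc l) % 2 ℕ.≟ (2 ℕ.+ k ℕ.+ suc l) % 2) refl) ⟩
  ⌊ length s ℕ.≟ l ⌋ ∧ (parityOK (2 ℕ.+ k) (suc l) 1 s ∧ true)
    ≡⟨ cong (⌊ length s ℕ.≟ l ⌋ ∧_)
            (trans (∧-identityʳ (parityOK (2 ℕ.+ k) (suc l) 1 s)) (parityOK-suc (suc k) l 1 s)) ⟩
  inI (suc k) l s ∎

inI-∷ʳ-below-top : ∀ k l s → inI (2 ℕ.+ k) (suc l) (s ∷ʳ suc k) ≡ false
inI-∷ʳ-below-top k l s = begin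
  inI (2 ℕ.+ k) (suc l) (s ∷ʳ suc k)
    ≡⟨ inI-∷ʳ (2 ℕ.+ k) l s (suc k) ⟩
  ⌊ length s ℕ.≟ l ⌋ ∧ (parityOK (2 ℕ.+ k) (suc l) 1 s ∧ parityAt (2 ℕ.+ k) (suc l) (suc l) (suc k))
    ≡⟨ cong (λ b → ⌊ length s ℕ.≟ l ⌋ ∧ (parityOK (2 ℕ.+ k) (suc l) 1 s ∧ b))
            (⌊⌋-false ((suc k ℕ.+ suc l) % 2 ℕ.≟ (2 ℕ.+ k ℕ.+ suc l) % 2) (n%2≢[1+n]%2 (suc k ℕ.+ suc l))) ⟩
  ⌊ length s ℕ.≟ l ⌋ ∧ (parityOK (2 ℕ.+ k) (suc l) 1 s ∧ false)
    ≡⟨ cong (⌊ length s ℕ.≟ l ⌋ ∧_) (∧-zeroʳ (parityOK (2 ℕ.+ k) (suc l) 1 s)) ⟩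
  ⌊ length s ℕ.≟ l ⌋ ∧ false
    ≡⟨ ∧-zeroʳ ⌊ length s ℕ.≟ l ⌋ ⟩
  false ∎

if-*ˡ : ∀ b (u c : ℤ) → (if b then u * c else + 0) ≡ c * (if b then u else + 0)
if-*ˡ true  u c = ℤₚ.*-comm u c
if-*ˡ false u c = sym (ℤₚ.*-zeroʳ c)

module _ (a : ℕ → ℕ) where

  weight : List ℕ → ℤ
  weight s = prodℤ (map (λ t → + a t) s)

  γ-summand : ℕ → ℕ → List ℕ → ℤ
  γ-summand k l s = if inI k l s then weight s else + 0

  Σγ-summand : ℕ → ℕ → List ℕ → ℤ
  Σγ-summand k l xs = sumℤ (map (γ-summand k l) (sublists xs))

  γ≡Σγ-summand : ∀ k l → γ a k l ≡ Σγ-summand k l (oneTo k)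
  γ≡Σγ-summand k zero    = sym (sumℤ-sublists-[] (γ-summand k 0) (oneTo k) (λ _ _ → refl))
  γ≡Σγ-summand k (suc l) = sumℤ-filter weight (inI k (suc l)) (sublists (oneTo k))

  -- Split I_{k+2,l+1} according to whether the last entry is k + 2; it is never k + 1.
  γ-rec : ∀ k l → γ a (2 ℕ.+ k) (suc l) ≡ + a (2 ℕ.+ k) * γ a (suc k) l + γ a k (suc l)
  γ-rec k l = begin
    γ a (2 ℕ.+ k) (suc l)
      ≡⟨ γ≡Σγ-summand (2 ℕ.+ k) (suc l) ⟩
    Σγ-summand (2 ℕ.+ k) (suc l) (oneTo (2 ℕ.+ k))
      ≡⟨ cong (Σγ-summand (2 ℕ.+ k) (suc l)) (oneTo-suc (suc k)) ⟩
    Σγ-summand (2 ℕ.+ k) (suc l) (oneTo (suc k) ∷ʳ (2 ℕ.+ k))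
      ≡⟨ sumℤ-sublists-∷ʳ g (oneTo (suc k)) (2 ℕ.+ k) ⟩
    sumℤ (map (λ s → g (s ∷ʳ (2 ℕ.+ k))) (sublists (oneTo (suc k)))) + Σγ-summand (2 ℕ.+ k) (suc l) (oneTo (suc k))
      ≡⟨ cong₂ _+_ ending-in-top ending-below-top ⟩
    + a (2 ℕ.+ k) * γ a (suc k) l + γ a k (suc l) ∎
    where
    g : List ℕ → ℤ
    g = γ-summand (2 ℕ.+ k) (suc l)

    g-∷ʳ-top : ∀ s → g (s ∷ʳ (2 ℕ.+ k)) ≡ + a (2 ℕ.+ k) * γ-summand (suc k) l s
    g-∷ʳ-top s = begin
      g (s ∷ʳ (2 ℕ.+ k))
        ≡⟨ cong₂ (λ b w → if b then w else + 0)
                 (inI-∷ʳ-top k l s) (prodℤ-map-∷ʳ (λ t → + a t) s (2 ℕ.+ k)) ⟩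
      (if inI (suc k) l s then weight s * + a (2 ℕ.+ k) else + 0)
        ≡⟨ if-*ˡ (inI (suc k) l s) (weight s) (+ a (2 ℕ.+ k)) ⟩
      + a (2 ℕ.+ k) * γ-summand (suc k) l s ∎

    ending-in-top :
      sumℤ (map (λ s → g (s ∷ʳ (2 ℕ.+ k))) (sublists (oneTo (suc k)))) ≡ + a (2 ℕ.+ k) * γ a (suc k) l
    ending-in-top = begin
      sumℤ (map (λ s → g (s ∷ʳ (2 ℕ.+ k))) (sublists (oneTo (suc k))))
        ≡⟨ sumℤ-map-cong g-∷ʳ-top (sublists (oneTo (suc k))) ⟩
      sumℤ (map (λ s → + a (2 ℕ.+ k) * γ-summand (suc k) l s) (sublists (oneTo (suc k))))
        ≡⟨ sumℤ-map-*ˡ (+ a (2 ℕ.+ k)) (γ-summand (suc k) l) (sublists (oneTo (suc k))) ⟩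
      + a (2 ℕ.+ k) * Σγ-summand (suc k) l (oneTo (suc k))
        ≡⟨ cong (+ a (2 ℕ.+ k) *_) (γ≡Σγ-summand (suc k) l) ⟨
      + a (2 ℕ.+ k) * γ a (suc k) l ∎

    ending-below-top : Σγ-summand (2 ℕ.+ k) (suc l) (oneTo (suc k)) ≡ γ a k (suc l)
    ending-below-top = begin
      Σγ-summand (2 ℕ.+ k) (suc l) (oneTo (suc k))
        ≡⟨ cong (Σγ-summand (2 ℕ.+ k) (suc l)) (oneTo-suc k) ⟩
      Σγ-summand (2 ℕ.+ k) (suc l) (oneTo k ∷ʳ suc k)
        ≡⟨ sumℤ-sublists-∷ʳ g (oneTo k) (suc k) ⟩
      sumℤ (map (λ s → g (s ∷ʳ suc k)) (sublists (oneTo k))) + Σγ-summand (2 ℕ.+ k) (suc l) (oneTo k)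
        ≡⟨ cong₂ _+_
             (sumℤ-map-0 _ (sublists (oneTo k))
               (λ s → cong (λ b → if b then weight (s ∷ʳ suc k) else + 0) (inI-∷ʳ-below-top k l s)))
             (sumℤ-map-cong (λ s → cong (λ b → if b then weight s else + 0) (inI-+2 k (suc l) s))
               (sublists (oneTo k))) ⟩
      + 0 + Σγ-summand k (suc l) (oneTo k)
        ≡⟨ ℤₚ.+-identityˡ _ ⟩
      Σγ-summand k (suc l) (oneTo k)
        ≡⟨ γ≡Σγ-summand k (suc l) ⟨
      γ a k (suc l) ∎

  -- γ a 1 1 computes to + a 1 * + 1 + + 0.
  γ-1-1 : γ a 1 1 ≡ + a 1
  γ-1-1 = trans (ℤₚ.+-identityʳ (+ a 1 * + 1)) (ℤₚ.*-identityʳ (+ a 1))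

  γ-vanish : ∀ {k l} → k < l → γ a k l ≡ + 0
  γ-vanish {zero}        {suc l}       _             = refl
  γ-vanish {suc zero}    {suc zero}    (s≤s ())
  γ-vanish {suc zero}    {suc (suc l)} _             = refl
  γ-vanish {suc (suc k)} {suc l}       (s≤s 1+k<l)   = begin
    γ a (2 ℕ.+ k) (suc l)                        ≡⟨ γ-rec k l ⟩
    + a (2 ℕ.+ k) * γ a (suc k) l + γ a k (suc l) ≡⟨ cong₂ (λ u v → + a (2 ℕ.+ k) * u + v)
                                                     (γ-vanish 1+k<l) (γ-vanish k<1+l) ⟩
    + a (2 ℕ.+ k) * + 0 + + 0                   ≡⟨ ℤₚ.+-identityʳ _ ⟩
    + a (2 ℕ.+ k) * + 0                         ≡⟨ ℤₚ.*-zeroʳ (+ a (2 ℕ.+ k)) ⟩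
    + 0                                          ∎
    where
    k<1+l : k < suc l
    k<1+l = ℕₚ.<-trans (ℕₚ.n<1+n k) (ℕₚ.m<n⇒m<1+n 1+k<l)

-- Alternating sums

-- alt z c M = Σ_{j ≤ M} (-1)^j z^(M - j) c j, in Horner form.
alt : ℤ → (ℕ → ℤ) → ℕ → ℤ
alt z c zero    = c 0
alt z c (suc M) = z * alt z c M + -1ℤ ^ suc M * c (suc M)

alt-vanish : ∀ z c M → c (suc M) ≡ + 0 → alt z c (suc M) ≡ z * alt z c M
alt-vanish z c M c≡0 = begin
  z * alt z c M + -1ℤ ^ suc M * c (suc M) ≡⟨ cong (λ u → z * alt z c M + -1ℤ ^ suc M * u) c≡0 ⟩
  z * alt z c M + -1ℤ ^ suc M * + 0      ≡⟨ cong (_+_ (z * alt z c M)) (ℤₚ.*-zeroʳ (-1ℤ ^ suc M)) ⟩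
  z * alt z c M + + 0                    ≡⟨ ℤₚ.+-identityʳ _ ⟩
  z * alt z c M                          ∎

Σto-suc : ∀ m f → Σto (suc m) f ≡ f 0 + Σto m (f ∘ suc)
Σto-suc m f = begin
  sumℤ (map f (upTo (2 ℕ.+ m)))            ≡⟨ cong sumℤ (Listₚ.map-upTo f (2 ℕ.+ m)) ⟩
  f 0 + sumℤ (applyUpTo (f ∘ suc) (suc m)) ≡⟨ cong (λ l → f 0 + sumℤ l) (Listₚ.map-upTo (f ∘ suc) (suc m)) ⟨
  f 0 + Σto m (f ∘ suc)                    ∎

Σto-cong : ∀ m {f g} → (∀ k → k ≤ m → f k ≡ g k) → Σto m f ≡ Σto m g
Σto-cong zero    f≡g = cong (_+ + 0) (f≡g 0 z≤n)
Σto-cong (suc m) {f} {g} f≡g = begin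
  Σto (suc m) f         ≡⟨ Σto-suc m f ⟩
  f 0 + Σto m (f ∘ suc) ≡⟨ cong₂ _+_ (f≡g 0 z≤n) (Σto-cong m (λ k k≤m → f≡g (suc k) (s≤s k≤m))) ⟩
  g 0 + Σto m (g ∘ suc) ≡⟨ Σto-suc m g ⟨
  Σto (suc m) g         ∎

Σto-*ˡ : ∀ m c f → Σto m (λ k → c * f k) ≡ c * Σto m f
Σto-*ˡ m c f = sumℤ-map-*ˡ c f (upTo (suc m))

altTerm : ℤ → ℤ → (ℕ → ℤ) → ℕ → ℕ → ℤ
altTerm x y c M k = -1ℤ ^ (M ∸ k) * x ^ k * y ^ k * c (M ∸ k)

Σto-altTerm : ∀ x y c M → Σto M (altTerm x y c M) ≡ alt (x * y) c M
Σto-altTerm x y c zero    = unit-factors (c 0)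
  where
  unit-factors : ∀ u → + 1 * + 1 * + 1 * u + + 0 ≡ u
  unit-factors = solve-∀
Σto-altTerm x y c (suc M) = begin
  Σto (suc M) (altTerm x y c (suc M))
    ≡⟨ Σto-suc M (altTerm x y c (suc M)) ⟩
  altTerm x y c (suc M) 0 + Σto M (altTerm x y c (suc M) ∘ suc)
    ≡⟨ cong (_+_ (altTerm x y c (suc M) 0))
            (Σto-cong M (λ k _ → pull-xy (-1ℤ ^ (M ∸ k)) x (x ^ k) y (y ^ k) (c (M ∸ k)))) ⟩
  altTerm x y c (suc M) 0 + Σto M (λ k → x * y * altTerm x y c M k)
    ≡⟨ cong (_+_ (altTerm x y c (suc M) 0)) (Σto-*ˡ M (x * y) (altTerm x y c M)) ⟩
  altTerm x y c (suc M) 0 + x * y * Σto M (altTerm x y c M)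
    ≡⟨ cong (λ u → altTerm x y c (suc M) 0 + x * y * u) (Σto-altTerm x y c M) ⟩
  altTerm x y c (suc M) 0 + x * y * alt (x * y) c M
    ≡⟨ swap (-1ℤ ^ suc M) (c (suc M)) (x * y) (alt (x * y) c M) ⟩
  alt (x * y) c (suc M) ∎
  where
  pull-xy : ∀ s x xk y yk u → s * (x * xk) * (y * yk) * u ≡ x * y * (s * xk * yk * u)
  pull-xy = solve-∀
  swap : ∀ s u z v → s * + 1 * + 1 * u + z * v ≡ z * v + s * u
  swap = solve-∀

-- p_n and Q_n as alternating sums

evens odds : (ℕ → ℕ) → ℕ → ℕ → ℤ
evens a n j = γ a n (j ℕ.* 2)
odds  a n j = γ a n (suc (j ℕ.* 2))

pTerm : (ℕ → ℕ) → ℕ → ℤ → ℤ → ℕ → ℕ → ℕ → ℤ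
pTerm a n x y m r k = -1ℤ ^ (m ∸ k) * x ^ k * y ^ k * γ a n (n ∸ 2 ℕ.* k ∸ r)

-- The body of p with m and r₀ as parameters: p a n x y unfolds to pWith a n x y (n / 2) (n % 2).
pWith : (ℕ → ℕ) → ℕ → ℤ → ℤ → ℕ → ℕ → ℤ
pWith a n x y m r₀ =
  x ^ r₀ * Σto m (pTerm a n x y m r₀) + x ^ (1 ∸ r₀) * Σto (m ∸ (1 ∸ r₀)) (pTerm a n x y m (1 ∸ r₀))


m*2∸2*k≡[m∸k]*2 : ∀ m k → m ℕ.* 2 ∸ 2 ℕ.* k ≡ (m ∸ k) ℕ.* 2
m*2∸2*k≡[m∸k]*2 m k = trans (cong (m ℕ.* 2 ∸_) (ℕₚ.*-comm 2 k)) (sym (ℕₚ.*-distribʳ-∸ 2 m k))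

[1+m*2]∸2*k≡1+[m∸k]*2 : ∀ {m k} → k ≤ m → suc (m ℕ.* 2) ∸ 2 ℕ.* k ≡ suc ((m ∸ k) ℕ.* 2)
[1+m*2]∸2*k≡1+[m∸k]*2 {m} {k} k≤m = trans (ℕₚ.+-∸-assoc 1 2k≤2m) (cong suc (m*2∸2*k≡[m∸k]*2 m k))
  where
  2k≤2m : 2 ℕ.* k ≤ m ℕ.* 2
  2k≤2m = ℕₚ.≤-trans (ℕₚ.≤-reflexive (ℕₚ.*-comm 2 k)) (ℕₚ.*-monoˡ-≤ 2 k≤m)

Σto-pTerm : ∀ a n x y m r (idx : ℕ → ℕ) → (∀ k → k ≤ m → n ∸ 2 ℕ.* k ∸ r ≡ idx (m ∸ k)) →
  Σto m (pTerm a n x y m r) ≡ alt (x * y) (γ a n ∘ idx) m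
Σto-pTerm a n x y m r idx idx≡ =
  trans (Σto-cong m (λ k k≤m → cong (λ i → -1ℤ ^ (m ∸ k) * x ^ k * y ^ k * γ a n i) (idx≡ k k≤m)))
        (Σto-altTerm x y (γ a n ∘ idx) m)

module _ (a : ℕ → ℕ) (x y : ℤ) where

  p-odd : ∀ m → let n = suc (m ℕ.* 2) in
    p a n x y ≡ x * alt (x * y) (evens a n) m + alt (x * y) (odds a n) m
  p-odd m = begin
    p a n x y
      ≡⟨⟩
    pWith a n x y (n / 2) (n % 2)
      ≡⟨ cong₂ (pWith a n x y) (trans (+-distrib-/-∣ʳ 1 {m ℕ.* 2} {2} (divides m refl)) (m*n/n≡m m 2))
                               ([m+kn]%n≡m%n 1 m 2) ⟩
    x ^ 1 * Σto m (pTerm a n x y m 1) + x ^ 0 * Σto m (pTerm a n x y m 0)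
      ≡⟨ cong₂ (λ u v → x ^ 1 * u + x ^ 0 * v)
           (Σto-pTerm a n x y m 1 (ℕ._* 2) (λ k k≤m → cong (_∸ 1) ([1+m*2]∸2*k≡1+[m∸k]*2 k≤m)))
           (Σto-pTerm a n x y m 0 (λ j → suc (j ℕ.* 2)) (λ k → [1+m*2]∸2*k≡1+[m∸k]*2)) ⟩
    x ^ 1 * E + + 1 * O
      ≡⟨ cong₂ _+_ (cong (_* E) (ℤₚ.^-identityʳ x)) (ℤₚ.*-identityˡ O) ⟩
    x * E + O ∎
    where
    n = suc (m ℕ.* 2)
    E = alt (x * y) (evens a n) m
    O = alt (x * y) (odds a n) m

  p-even : ∀ M → let n = suc M ℕ.* 2 in
    p a n x y ≡ alt (x * y) (evens a n) (suc M) - x * alt (x * y) (odds a n) M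
  p-even M = begin
    p a n x y
      ≡⟨⟩
    pWith a n x y (n / 2) (n % 2)
      ≡⟨ cong₂ (pWith a n x y) (m*n/n≡m (suc M) 2) (m*n%n≡0 (suc M) 2) ⟩
    x ^ 0 * Σto (suc M) (pTerm a n x y (suc M) 0) + x ^ 1 * Σto M (pTerm a n x y (suc M) 1)
      ≡⟨ cong₂ (λ u v → x ^ 0 * u + x ^ 1 * v)
           (Σto-pTerm a n x y (suc M) 0 (ℕ._* 2) (λ k _ → m*2∸2*k≡[m∸k]*2 (suc M) k)) odd-part ⟩
    + 1 * E + x ^ 1 * (-1ℤ * O)
      ≡⟨ tidy x E O ⟩
    E - x * O ∎
    where
    n = suc M ℕ.* 2
    E = alt (x * y) (evens a n) (suc M)
    O = alt (x * y) (odds a n) M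

    tidy : ∀ x E O → + 1 * E + x * + 1 * (-1ℤ * O) ≡ E - x * O
    tidy = solve-∀

    odd-term : ∀ k → k ≤ M → pTerm a n x y (suc M) 1 k ≡ -1ℤ * altTerm x y (odds a n) M k
    odd-term k k≤M = begin
      -1ℤ ^ (suc M ∸ k) * x ^ k * y ^ k * γ a n (n ∸ 2 ℕ.* k ∸ 1)
        ≡⟨ cong (λ i → -1ℤ ^ (suc M ∸ k) * x ^ k * y ^ k * γ a n (i ∸ 1)) (m*2∸2*k≡[m∸k]*2 (suc M) k) ⟩
      -1ℤ ^ (suc M ∸ k) * x ^ k * y ^ k * γ a n ((suc M ∸ k) ℕ.* 2 ∸ 1)
        ≡⟨ cong (λ j → -1ℤ ^ j * x ^ k * y ^ k * γ a n (j ℕ.* 2 ∸ 1)) (ℕₚ.+-∸-assoc 1 k≤M) ⟩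
      -1ℤ * -1ℤ ^ (M ∸ k) * x ^ k * y ^ k * odds a n (M ∸ k)
        ≡⟨ pull-sign (-1ℤ ^ (M ∸ k)) (x ^ k) (y ^ k) (odds a n (M ∸ k)) ⟩
      -1ℤ * altTerm x y (odds a n) M k ∎
      where
      pull-sign : ∀ s xk yk u → -1ℤ * s * xk * yk * u ≡ -1ℤ * (s * xk * yk * u)
      pull-sign = solve-∀

    odd-part : Σto M (pTerm a n x y (suc M) 1) ≡ -1ℤ * O
    odd-part = begin
      Σto M (pTerm a n x y (suc M) 1)                       ≡⟨ Σto-cong M odd-term ⟩
      Σto M (λ k → -1ℤ * altTerm x y (odds a n) M k)        ≡⟨ Σto-*ˡ M -1ℤ (altTerm x y (odds a n) M) ⟩
      -1ℤ * Σto M (altTerm x y (odds a n) M)                ≡⟨ cong (-1ℤ *_) (Σto-altTerm x y (odds a n) M) ⟩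
      -1ℤ * O                                               ∎

-1ℤ^[m*2]≡1 : ∀ m → -1ℤ ^ (m ℕ.* 2) ≡ + 1
-1ℤ^[m*2]≡1 zero    = refl
-1ℤ^[m*2]≡1 (suc m) = cong (λ u → -1ℤ * (-1ℤ * u)) (-1ℤ^[m*2]≡1 m)

module _ (a : ℕ → ℕ) (x : ℤ) where

  z : ℤ
  z = x * (x + + 1)

  E O : ℕ → ℕ → ℤ
  E n = alt z (evens a n)
  O n = alt z (odds a n)

  E-rec : ∀ n M → E (2 ℕ.+ n) (suc M) ≡ E n (suc M) - + a (2 ℕ.+ n) * O (suc n) M
  E-rec n zero = trans (cong (λ g → z * + 1 + -1ℤ ^ 1 * g) (γ-rec a n 1))
                       (regroup z (+ a (2 ℕ.+ n)) (γ a (suc n) 1) (γ a n 2))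
    where
    regroup : ∀ z A g₁ g₀ → z * + 1 + -1ℤ ^ 1 * (A * g₁ + g₀) ≡ (z * + 1 + -1ℤ ^ 1 * g₀) - A * g₁
    regroup = solve-∀
  E-rec n (suc M) = begin
    z * E (2 ℕ.+ n) (suc M) + -1ℤ * s * γ a (2 ℕ.+ n) (suc (suc (suc M ℕ.* 2)))
      ≡⟨ cong₂ (λ e g → z * e + -1ℤ * s * g) (E-rec n M) (γ-rec a n (suc (suc M ℕ.* 2))) ⟩
    z * (E n (suc M) - A * O (suc n) M) + -1ℤ * s * (A * odds a (suc n) (suc M) + evens a n (suc (suc M)))
      ≡⟨ regroup z (E n (suc M)) A (O (suc n) M) s (odds a (suc n) (suc M)) (evens a n (suc (suc M))) ⟩
    E n (suc (suc M)) - A * O (suc n) (suc M) ∎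
    where
    A = + a (2 ℕ.+ n)
    s = -1ℤ ^ suc M
    regroup : ∀ z e A o s g₁ g₀ →
      z * (e - A * o) + -1ℤ * s * (A * g₁ + g₀) ≡ (z * e + -1ℤ * s * g₀) - A * (z * o + s * g₁)
    regroup = solve-∀

  O-rec : ∀ n M → O (2 ℕ.+ n) M ≡ + a (2 ℕ.+ n) * E (suc n) M + O n M
  O-rec n zero    = γ-rec a n 0
  O-rec n (suc M) = begin
    z * O (2 ℕ.+ n) M + s * γ a (2 ℕ.+ n) (suc (suc M ℕ.* 2))
      ≡⟨ cong₂ (λ o g → z * o + s * g) (O-rec n M) (γ-rec a n (suc M ℕ.* 2)) ⟩
    z * (A * E (suc n) M + O n M) + s * (A * evens a (suc n) (suc M) + odds a n (suc M))
      ≡⟨ regroup z A (E (suc n) M) (O n M) s (evens a (suc n) (suc M)) (odds a n (suc M)) ⟩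
    A * E (suc n) (suc M) + O n (suc M) ∎
    where
    A = + a (2 ℕ.+ n)
    s = -1ℤ ^ suc M
    regroup : ∀ z A e o s g₁ g₀ → z * (A * e + o) + s * (A * g₁ + g₀) ≡ A * (z * e + s * g₁) + (z * o + s * g₀)
    regroup = solve-∀

  Q-rec : ∀ n → Q a x (2 ℕ.+ n) ≡ -1ℤ ^ suc n * + a (2 ℕ.+ n) * Q a x (suc n) + z * Q a x n
  Q-rec n = cong₂ (λ s A → s * A * Q a x (suc n) + z * Q a x n)
                  (trans (cong (-1ℤ ^_) (ℕₚ.+-comm n 3)) (three-signs (-1ℤ ^ n)))
                  (cong (λ i → + a i) (ℕₚ.+-comm n 2))
    where
    three-signs : ∀ s → -1ℤ * (-1ℤ * (-1ℤ * s)) ≡ -1ℤ * s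
    three-signs = solve-∀

  -- p_{2m+1} and p_{2m+2}, by p-odd and p-even.
  pOdd pEven : ℕ → ℤ
  pOdd  m = x * E (suc (m ℕ.* 2)) m + O (suc (m ℕ.* 2)) m
  pEven m = E (suc m ℕ.* 2) (suc m) - x * O (suc m ℕ.* 2) m

  Q-odd-step : ∀ m → Q a x (suc (m ℕ.* 2)) ≡ pOdd m → Q a x (suc m ℕ.* 2) ≡ pEven m →
    Q a x (suc (suc m ℕ.* 2)) ≡ pOdd (suc m)
  Q-odd-step m Q₁≡ Q₂≡ = begin
    Q a x (2 ℕ.+ n₁)
      ≡⟨ Q-rec n₁ ⟩
    -1ℤ ^ (suc m ℕ.* 2) * A * Q a x n₂ + z * Q a x n₁
      ≡⟨ cong₂ (λ s q → s * A * q + z * Q a x n₁) (-1ℤ^[m*2]≡1 (suc m)) Q₂≡ ⟩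
    + 1 * A * pEven m + z * Q a x n₁
      ≡⟨ cong (λ q → + 1 * A * pEven m + z * q) Q₁≡ ⟩
    + 1 * A * pEven m + z * pOdd m
      ≡⟨ regroup x z A (E n₂ (suc m)) (O n₂ m) (E n₁ m) (O n₁ m) ⟩
    x * (z * E n₁ m - A * O n₂ m) + (A * E n₂ (suc m) + z * O n₁ m)
      ≡⟨ cong₂ (λ e o → x * (e - A * O n₂ m) + (A * E n₂ (suc m) + o))
           (alt-vanish z (evens a n₁) m (γ-vanish a (ℕₚ.n<1+n n₁)))
           (alt-vanish z (odds a n₁) m (γ-vanish a (ℕₚ.m<n⇒m<1+n (ℕₚ.n<1+n n₁)))) ⟨
    x * (E n₁ (suc m) - A * O n₂ m) + (A * E n₂ (suc m) + O n₁ (suc m))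
      ≡⟨ cong₂ (λ e o → x * e + o) (E-rec n₁ m) (O-rec n₁ (suc m)) ⟨
    pOdd (suc m) ∎
    where
    n₁ = suc (m ℕ.* 2)
    n₂ = suc m ℕ.* 2
    A = + a (2 ℕ.+ n₁)
    regroup : ∀ x z A e₂ o₂ e₁ o₁ →
      + 1 * A * (e₂ - x * o₂) + z * (x * e₁ + o₁) ≡ x * (z * e₁ - A * o₂) + (A * e₂ + z * o₁)
    regroup = solve-∀

  Q-even-step : ∀ m → Q a x (suc m ℕ.* 2) ≡ pEven m → Q a x (suc (suc m ℕ.* 2)) ≡ pOdd (suc m) →
    Q a x (suc (suc m) ℕ.* 2) ≡ pEven (suc m)
  Q-even-step m Q₂≡ Q₃≡ = begin
    Q a x (2 ℕ.+ n₂)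
      ≡⟨ Q-rec n₂ ⟩
    -1ℤ * -1ℤ ^ n₂ * B * Q a x n₃ + z * Q a x n₂
      ≡⟨ cong₂ (λ s q → -1ℤ * s * B * q + z * Q a x n₂) (-1ℤ^[m*2]≡1 (suc m)) Q₃≡ ⟩
    -1ℤ * + 1 * B * pOdd (suc m) + z * Q a x n₂
      ≡⟨ cong (λ q → -1ℤ * + 1 * B * pOdd (suc m) + z * q) Q₂≡ ⟩
    -1ℤ * + 1 * B * pOdd (suc m) + z * pEven m
      ≡⟨ regroup x z B (E n₃ (suc m)) (O n₃ (suc m)) (E n₂ (suc m)) (O n₂ m) ⟩
    (z * E n₂ (suc m) - B * O n₃ (suc m)) - x * (B * E n₃ (suc m) + z * O n₂ m)
      ≡⟨ cong₂ (λ e o → (e - B * O n₃ (suc m)) - x * (B * E n₃ (suc m) + o))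
           (alt-vanish z (evens a n₂) (suc m) (γ-vanish a (ℕₚ.m<n⇒m<1+n (ℕₚ.n<1+n n₂))))
           (alt-vanish z (odds a n₂) m (γ-vanish a (ℕₚ.n<1+n n₂))) ⟨
    (E n₂ (suc (suc m)) - B * O n₃ (suc m)) - x * (B * E n₃ (suc m) + O n₂ (suc m))
      ≡⟨ cong₂ (λ e o → e - x * o) (E-rec n₂ (suc m)) (O-rec n₂ (suc m)) ⟨
    pEven (suc m) ∎
    where
    n₂ = suc m ℕ.* 2
    n₃ = suc n₂
    B = + a (2 ℕ.+ n₂)
    regroup : ∀ x z B e₃ o₃ e₂ o₂ →
      -1ℤ * + 1 * B * (x * e₃ + o₃) + z * (e₂ - x * o₂) ≡ (z * e₂ - B * o₃) - x * (B * e₃ + z * o₂)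
    regroup = solve-∀

  Q₁≡pOdd0 : Q a x 1 ≡ pOdd 0
  Q₁≡pOdd0 = cong₂ _+_ (sym (ℤₚ.*-identityʳ x)) (sym (γ-1-1 a))

  Q₂≡pEven0 : Q a x 2 ≡ pEven 0
  Q₂≡pEven0 = begin
    -1ℤ ^ 3 * A₂ * (x + + a 1) + z * + 1
      ≡⟨ regroup x A₂ (+ a 1) ⟩
    (z * + 1 + -1ℤ ^ 1 * + 0 - A₂ * + a 1) - x * (A₂ * + 1 + + 0)
      ≡⟨ cong (λ g → (z * + 1 + -1ℤ ^ 1 * + 0 - A₂ * g) - x * (A₂ * + 1 + + 0)) (γ-1-1 a) ⟨
    (E 0 1 - A₂ * O 1 0) - x * (A₂ * E 1 0 + O 0 0)
      ≡⟨ cong₂ (λ e o → e - x * o) (E-rec 0 0) (O-rec 0 0) ⟨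
    pEven 0 ∎
    where
    A₂ = + a 2
    regroup : ∀ x A₂ A₁ → -1ℤ ^ 3 * A₂ * (x + A₁) + x * (x + + 1) * + 1
                          ≡ (x * (x + + 1) * + 1 + -1ℤ ^ 1 * + 0 - A₂ * A₁) - x * (A₂ * + 1 + + 0)
    regroup = solve-∀

  Q-forms : ∀ m → Q a x (suc (m ℕ.* 2)) ≡ pOdd m × Q a x (suc m ℕ.* 2) ≡ pEven m
  Q-forms zero    = Q₁≡pOdd0 , Q₂≡pEven0
  Q-forms (suc m) = Q₃≡ , Q-even-step m Q₂≡ Q₃≡
    where
    Q₁≡ = proj₁ (Q-forms m)
    Q₂≡ = proj₂ (Q-forms m)
    Q₃≡ = Q-odd-step m Q₁≡ Q₂≡

data Parity : ℕ → Set where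
  even : ∀ m → Parity (m ℕ.* 2)
  odd  : ∀ m → Parity (suc (m ℕ.* 2))

parity : ∀ n → Parity n
parity zero = even 0
parity (suc n) with parity n
... | even m = odd m
... | odd  m = even (suc m)

corollary1 : (a : ℕ → ℕ) → (∀ i → 1 ≤ i → 0 < a i) →
    ∀ (n : ℕ) → 2 ≤ n → ∀ (x : ℤ) → Q a x n ≡ p a n x (x + + 1)
corollary1 a _ n 2≤n x with parity n
... | odd m        = trans (proj₁ (Q-forms a x m)) (sym (p-odd a x (x + + 1) m))
... | even (suc m) = trans (proj₂ (Q-forms a x m)) (sym (p-even a x (x + + 1) m))
... | even zero    = contradiction 2≤n λ ()
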